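{- For any $n\in\mathbb{N}$, \[ \prod_{j=-1}^{n-1}(v_{2j}w_{2j+1})^{d_{2j+3}}=\prod_{j=-1}^{2n-1}v_j. \]
   Context: Words over $\{a,b\}$; $\varepsilon$ empty word; $x^{ -1}$ inverse in the free group (used only where the result is a word). $\prod_{j=m}^M x_j=x_mx_{m+1}\cdots x_M$. Standing assumption: $\alpha=[0;1+d_1,d_2,d_3,\ldots]$ irrational, all integers $d_i\ge1$. $s_{ -1}=b$, $s_0=a$, $s_n=s_{n-1}^{d_n}s_{n-2}$ ($n\ge1$). $w_{ -1}=a$, for $n\ge0$: $w_n=as_nb^{ -1}$ ($n$ odd), $w_n=bs_na^{ -1}$ ($n$ even). $v_{ -2}=\varepsilon$, for $n\ge-1$: $v_n=as_{n+1}^{d_{n+2}-1}s_nb^{ -1}$ ($n$ odd), $v_n=bs_{n+1}^{d_{n+2}-1}s_na^{ -1}$ ($n$ even). -}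

module Defs where

open import Data.Nat using (ℕ; zero; suc; _+_; _*_; _∸_; _%_; _≡ᵇ_)
open import Data.Integer using (ℤ; +_; -[1+_]; ∣_∣) renaming (_+_ to _+ℤ_; _-_ to _-ℤ_)
open import Data.Bool using (Bool; true; false; if_then_else_; _∧_; not)
open import Data.List using (List; []; _∷_; _++_; foldr; concat; map; upTo)
open import Data.Product using (_×_; _,_; proj₁; proj₂)

data Gen : Set where
  ga gb : Gen

_≟G_ : Gen → Gen → Bool
ga ≟G ga = true
gb ≟G gb = true
_  ≟G _  = false

-- A literal: generator with exponent sign (true = +1, false = -1).
Lit : Set
Lit = Gen × Bool

-- Free-group expressions: (not necessarily reduced) lists of literals;
-- multiplication is concatenation. Ordinary words over {a,b} are the
-- lists of positive literals.
FG : Set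
FG = List Lit

a b a⁻¹ b⁻¹ ε : FG
a = (ga , true) ∷ []
b = (gb , true) ∷ []
a⁻¹ = (ga , false) ∷ []
b⁻¹ = (gb , false) ∷ []
ε = []

pow : FG → ℕ → FG
pow x zero = []
pow x (suc k) = x ++ pow x k

-- Free reduction: normal form of an element of the free group.
-- Two expressions denote the same free-group element iff their
-- normal forms are equal.
inverseLit : Lit → Lit → Bool
inverseLit (g , e) (h , f) = (g ≟G h) ∧ not (e ≟B f)
  where
  _≟B_ : Bool → Bool → Bool
  true  ≟B true  = true
  false ≟B false = true
  _     ≟B _     = false

step : Lit → FG → FG
step x [] = x ∷ []
step x (y ∷ ys) = if inverseLit x y then ys else x ∷ y ∷ ys

norm : FG → FG
norm = foldr step []

isOdd : ℤ → Bool
isOdd n = (∣ n ∣ % 2) ≡ᵇ 1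

-- The sequence d : ℕ → ℕ; only d 1, d 2, ... are meaningful (d 0 unused).
module _ (d : ℕ → ℕ) where

  -- sPair n = (s_{n-1}, s_n)
  sPair : ℕ → FG × FG
  sPair zero = (b , a)
  sPair (suc n) = (proj₂ (sPair n) , pow (proj₂ (sPair n)) (d (suc n)) ++ proj₁ (sPair n))

  -- s_n for n ≥ -1 (junk value ε for n < -1, never used)
  s : ℤ → FG
  s (+ n) = proj₂ (sPair n)
  s -[1+ zero ] = b
  s -[1+ suc _ ] = ε

  -- w_n for n ≥ -1 (junk ε for n < -1, never used)
  w : ℤ → FG
  w -[1+ zero ] = a
  w -[1+ suc _ ] = ε
  w (+ n) = if isOdd (+ n) then a ++ s (+ n) ++ b⁻¹ else b ++ s (+ n) ++ a⁻¹

  -- v_n for n ≥ -2 (junk ε for n < -2, never used)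
  v : ℤ → FG
  v -[1+ suc (suc _) ] = ε
  v -[1+ suc zero ] = ε
  v n = if isOdd n
          then a ++ pow (s (n +ℤ + 1)) (d ∣ n +ℤ + 2 ∣ ∸ 1) ++ s n ++ b⁻¹
          else b ++ pow (s (n +ℤ + 1)) (d ∣ n +ℤ + 2 ∣ ∸ 1) ++ s n ++ a⁻¹

  -- LHS: ∏_{j=-1}^{n-1} (v_{2j} w_{2j+1})^{d_{2j+3}}, reindexed by i = j+1 ∈ {0..n}
  lhs : ℕ → FG
  lhs n = concat (map (λ i → pow (v (+ (2 * i) -ℤ + 2) ++ w (+ (2 * i) -ℤ + 1)) (d (2 * i + 1)))
                      (upTo (suc n)))

  -- RHS: ∏_{j=-1}^{2n-1} v_j, reindexed by i = j+1 ∈ {0..2n}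
  rhs : ℕ → FG
  rhs n = concat (map (λ i → v (+ i -ℤ + 1)) (upTo (suc (2 * n))))

module Submission where

-- Both products are compared in the free group on {a, b}:
-- two words are identified when they have the same free reduction
-- ('norm').  Writing S = s_{2j+1}, T = s_{2j}, D = d_{2j+2}, E = d_{2j+3},
-- the j-th factor of the left product is
--     v_{2j} w_{2j+1} = (b S^{D-1} T a⁻¹)(a S b⁻¹) = b (S^{D-1} T S) b⁻¹,
-- so its E-th power is the conjugate b (S^{D-1} T S)^E b⁻¹.  Rotating
-- the power, (S^{D-1} T S)^E = S^{D-1} T (S^D T)^{E-1} S, and since
-- S^D T = s_{2j+2} this equals v_{2j} v_{2j+1} after inserting a⁻¹ a.
-- Hence each factor of the left product is the product of two
-- consecutive factors of the right one, and the theorem follows by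
-- induction on n (the factor j = -1 is a^{d_1} = a s_0^{d_1-1} s_{-1} b⁻¹).

open import Defs
open import Data.Nat using (ℕ; suc; _≤_)
open import Relation.Binary.PropositionalEquality using (_≡_)

open import Data.Nat using (zero; _+_; _*_; _∸_)
open import Data.Nat.Properties using (+-comm; *-comm; *-suc; m≤m+n; m+n∸m≡n)
open import Data.Nat.DivMod using ([m+kn]%n≡m%n)
open import Data.Integer using (+_) renaming (_-_ to _-ℤ_)
open import Data.Integer.Properties using ([+m]-[+n]≡m⊖n; ⊖-≥)
open import Data.Bool using (true; false; not)
open import Data.Bool.Properties using (not-involutive)
open import Data.List using (List; []; _∷_; _++_; foldr; concat; map; upTo; [_])
open import Data.List.Properties
  using (++-assoc; ++-identityʳ; foldr-++; map-++; concat-++; upTo-∷ʳ)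
open import Data.Product using (_,_)
open import Relation.Binary.Bundles using (Setoid)
import Relation.Binary.Reasoning.Setoid
open import Relation.Binary.PropositionalEquality
  using (refl; sym; trans; cong; cong₂; subst; module ≡-Reasoning)

inv : Lit → Lit
inv (g , e) = (g , not e)

inv-involutive : ∀ l → inv (inv l) ≡ l
inv-involutive (g , e) = cong (g ,_) (not-involutive e)

inverseLit-inv : ∀ l → inverseLit l (inv l) ≡ true
inverseLit-inv (ga , true)  = refl
inverseLit-inv (ga , false) = refl
inverseLit-inv (gb , true)  = refl
inverseLit-inv (gb , false) = refl

inverseLit⇒inv : ∀ l m → inverseLit l m ≡ true → m ≡ inv l
inverseLit⇒inv (ga , true)  (ga , false) _ = refl
inverseLit⇒inv (ga , false) (ga , true)  _ = refl
inverseLit⇒inv (gb , true)  (gb , false) _ = refl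
inverseLit⇒inv (gb , false) (gb , true)  _ = refl
inverseLit⇒inv (ga , true)  (ga , true)  ()
inverseLit⇒inv (ga , false) (ga , false) ()
inverseLit⇒inv (gb , true)  (gb , true)  ()
inverseLit⇒inv (gb , false) (gb , false) ()
inverseLit⇒inv (ga , _)     (gb , _)     ()
inverseLit⇒inv (gb , _)     (ga , _)     ()

data Reduced : FG → Set where
  []-reduced  : Reduced []
  [-]-reduced : ∀ l → Reduced (l ∷ [])
  ∷-reduced   : ∀ {l m u} → inverseLit l m ≡ false → Reduced (m ∷ u) →
                Reduced (l ∷ m ∷ u)

reduced-tail : ∀ {l u} → Reduced (l ∷ u) → Reduced u
reduced-tail ([-]-reduced _)  = []-reduced
reduced-tail (∷-reduced _ ru) = ru

step-reduced : ∀ l u → Reduced u → Reduced (step l u)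
step-reduced l []      _  = [-]-reduced l
step-reduced l (m ∷ u) ru with inverseLit l m in lm
... | true  = reduced-tail ru
... | false = ∷-reduced lm ru

norm-reduced : ∀ u → Reduced (norm u)
norm-reduced []      = []-reduced
norm-reduced (l ∷ u) = step-reduced l (norm u) (norm-reduced u)

step-on-reduced : ∀ l u → Reduced (l ∷ u) → step l u ≡ l ∷ u
step-on-reduced l []      _                = refl
step-on-reduced l (m ∷ u) (∷-reduced lm _) rewrite lm = refl

step-inv-cancel : ∀ l u → Reduced u → step l (step (inv l) u) ≡ u
step-inv-cancel l [] _ rewrite inverseLit-inv l = refl
step-inv-cancel l (m ∷ u) ru with inverseLit (inv l) m in il-m
... | false rewrite inverseLit-inv l = refl
... | true with inverseLit⇒inv (inv l) m il-m
...   | refl rewrite inv-involutive l = step-on-reduced l u ru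

norm-step-++ : ∀ l u z → norm (step l u ++ z) ≡ step l (norm (u ++ z))
norm-step-++ l []      z = refl
norm-step-++ l (m ∷ u) z with inverseLit l m in lm
... | false = refl
... | true with inverseLit⇒inv l m lm
...   | refl = sym (step-inv-cancel l (norm (u ++ z)) (norm-reduced (u ++ z)))

norm-++-norm : ∀ x y → norm (x ++ y) ≡ norm (norm x ++ y)
norm-++-norm []      y = refl
norm-++-norm (l ∷ x) y =
  trans (cong (step l) (norm-++-norm x y)) (sym (norm-step-++ l (norm x) y))

-- Equality in the free group: equal free reductions.  (A record, so that
-- the two words can be inferred from a proof.)
infix 4 _≈_
record _≈_ (x y : FG) : Set where
  constructor by-norm
  field norm-≡ : norm x ≡ norm y
open _≈_

≈-setoid : Setoid _ _
≈-setoid = record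
  { Carrier       = FG
  ; _≈_           = _≈_
  ; isEquivalence = record
    { refl  = by-norm refl
    ; sym   = λ (by-norm e) → by-norm (sym e)
    ; trans = λ (by-norm e) (by-norm f) → by-norm (trans e f)
    }
  }

open Setoid ≈-setoid using () renaming (sym to ≈-sym; trans to ≈-trans)
module ≈-Reasoning = Relation.Binary.Reasoning.Setoid ≈-setoid

++-congˡ : ∀ p {y y′} → y ≈ y′ → p ++ y ≈ p ++ y′
++-congˡ p {y} {y′} (by-norm e) = by-norm (begin
  norm (p ++ y)         ≡⟨ foldr-++ step [] p y ⟩
  foldr step (norm y) p  ≡⟨ cong (λ r → foldr step r p) e ⟩
  foldr step (norm y′) p ≡⟨ foldr-++ step [] p y′ ⟨
  norm (p ++ y′)        ∎)
  where open ≡-Reasoning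

++-congʳ : ∀ q {x x′} → x ≈ x′ → x ++ q ≈ x′ ++ q
++-congʳ q {x} {x′} (by-norm e) = by-norm (begin
  norm (x ++ q)        ≡⟨ norm-++-norm x q ⟩
  norm (norm x ++ q)   ≡⟨ cong (λ r → norm (r ++ q)) e ⟩
  norm (norm x′ ++ q)  ≡⟨ norm-++-norm x′ q ⟨
  norm (x′ ++ q)       ∎)
  where open ≡-Reasoning

++-cong : ∀ {x x′ y y′} → x ≈ x′ → y ≈ y′ → x ++ y ≈ x′ ++ y′
++-cong {x′ = x′} {y} e f = ≈-trans (++-congʳ y e) (++-congˡ x′ f)

pow-cong : ∀ k {x x′} → x ≈ x′ → pow x k ≈ pow x′ k
pow-cong zero    e = by-norm refl
pow-cong (suc k) e = ++-cong e (pow-cong k e)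

cancel-inside : ∀ x l y → x ++ l ∷ inv l ∷ y ≈ x ++ y
cancel-inside x l y =
  ++-congˡ x (by-norm (step-inv-cancel l (norm y) (norm-reduced y)))

cancel-inside′ : ∀ x l y → x ++ inv l ∷ l ∷ y ≈ x ++ y
cancel-inside′ x l y =
  subst (λ m → x ++ inv l ∷ m ∷ y ≈ x ++ y) (inv-involutive l)
        (cancel-inside x (inv l) y)

pow-slide : ∀ S Y k → S ++ pow (Y ++ S) k ≡ pow (S ++ Y) k ++ S
pow-slide S Y zero    = ++-identityʳ S
pow-slide S Y (suc k) = begin
  S ++ (Y ++ S) ++ pow (Y ++ S) k    ≡⟨ cong (S ++_) (++-assoc Y S _) ⟩
  S ++ Y ++ S ++ pow (Y ++ S) k      ≡⟨ cong (λ r → S ++ Y ++ r) (pow-slide S Y k) ⟩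
  S ++ Y ++ pow (S ++ Y) k ++ S      ≡⟨ ++-assoc S Y _ ⟨
  (S ++ Y) ++ pow (S ++ Y) k ++ S    ≡⟨ ++-assoc (S ++ Y) _ S ⟨
  ((S ++ Y) ++ pow (S ++ Y) k) ++ S  ∎
  where open ≡-Reasoning

pow-rotate : ∀ X Y k → pow (X ++ Y) (suc k) ≡ X ++ pow (Y ++ X) k ++ Y
pow-rotate X Y k = begin
  (X ++ Y) ++ pow (X ++ Y) k  ≡⟨ ++-assoc X Y _ ⟩
  X ++ Y ++ pow (X ++ Y) k    ≡⟨ cong (X ++_) (pow-slide Y X k) ⟩
  X ++ pow (Y ++ X) k ++ Y    ∎
  where open ≡-Reasoning

conj-pow : ∀ l Y k → pow (l ∷ Y ++ [ inv l ]) k ≈ l ∷ pow Y k ++ [ inv l ]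
conj-pow l Y zero    = ≈-sym (cancel-inside [] l [])
conj-pow l Y (suc k) = begin
  (l ∷ Y ++ [ inv l ]) ++ pow (l ∷ Y ++ [ inv l ]) k
    ≈⟨ ++-congˡ (l ∷ Y ++ [ inv l ]) (conj-pow l Y k) ⟩
  (l ∷ Y ++ [ inv l ]) ++ l ∷ pow Y k ++ [ inv l ]
    ≡⟨ cong (l ∷_) (++-assoc Y [ inv l ] _) ⟩
  (l ∷ Y) ++ inv l ∷ l ∷ pow Y k ++ [ inv l ]
    ≈⟨ cancel-inside′ (l ∷ Y) l _ ⟩
  l ∷ Y ++ pow Y k ++ [ inv l ]
    ≡⟨ cong (l ∷_) (++-assoc Y (pow Y k) _) ⟨
  l ∷ (Y ++ pow Y k) ++ [ inv l ]
    ∎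
  where open ≈-Reasoning

junction : ∀ P T R → (b ++ P ++ T ++ a⁻¹) ++ (a ++ R) ≈ b ++ (P ++ T) ++ R
junction P T R = begin
  (b ++ P ++ T ++ a⁻¹) ++ (a ++ R)  ≡⟨ cong ((gb , true) ∷_) (++-assoc P (T ++ a⁻¹) _) ⟩
  b ++ P ++ (T ++ a⁻¹) ++ a ++ R    ≡⟨ cong (λ r → b ++ P ++ r) (++-assoc T a⁻¹ _) ⟩
  b ++ P ++ T ++ a⁻¹ ++ a ++ R      ≡⟨ cong ((gb , true) ∷_) (++-assoc P T _) ⟨
  (b ++ P ++ T) ++ a⁻¹ ++ a ++ R    ≈⟨ cancel-inside (b ++ P ++ T) (ga , false) R ⟩
  b ++ (P ++ T) ++ R                ∎
  where open ≈-Reasoning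

-- The word identity behind the theorem, for arbitrary words P, T, S:
-- (b P T a⁻¹ · a S b⁻¹)^(k+1) = b P T a⁻¹ · a (S P T)^k S b⁻¹.
-- Both sides equal the conjugate b (P T S)^(k+1) b⁻¹.
block-power : ∀ P T S k →
  pow ((b ++ P ++ T ++ a⁻¹) ++ (a ++ S ++ b⁻¹)) (suc k) ≈
  (b ++ P ++ T ++ a⁻¹) ++ (a ++ pow (S ++ P ++ T) k ++ S ++ b⁻¹)
block-power P T S k = begin
  pow ((b ++ P ++ T ++ a⁻¹) ++ (a ++ S ++ b⁻¹)) (suc k)
    ≈⟨ pow-cong (suc k) (junction P T (S ++ b⁻¹)) ⟩
  pow (b ++ (P ++ T) ++ S ++ b⁻¹) (suc k)
    ≡⟨ cong (λ r → pow ((gb , true) ∷ r) (suc k)) (++-assoc (P ++ T) S b⁻¹) ⟨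
  pow (b ++ X ++ b⁻¹) (suc k)
    ≈⟨ conj-pow (gb , true) X (suc k) ⟩
  b ++ pow X (suc k) ++ b⁻¹
    ≡⟨ cong (λ r → b ++ r ++ b⁻¹) (pow-rotate (P ++ T) S k) ⟩
  b ++ ((P ++ T) ++ Q ++ S) ++ b⁻¹
    ≡⟨ cong ((gb , true) ∷_) regroup ⟩
  b ++ (P ++ T) ++ Q ++ S ++ b⁻¹
    ≈⟨ junction P T (Q ++ S ++ b⁻¹) ⟨
  (b ++ P ++ T ++ a⁻¹) ++ (a ++ Q ++ S ++ b⁻¹)
    ∎
  where
  open ≈-Reasoning
  X = (P ++ T) ++ S
  Q = pow (S ++ P ++ T) k
  regroup : ((P ++ T) ++ Q ++ S) ++ b⁻¹ ≡ (P ++ T) ++ Q ++ S ++ b⁻¹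
  regroup = trans (++-assoc (P ++ T) (Q ++ S) b⁻¹) (cong ((P ++ T) ++_) (++-assoc Q S b⁻¹))

-- The same identity with the exponents of the paper: for S = s_{2j+1},
-- T = s_{2j}, D = d_{2j+2}, E = d_{2j+3} it reads (v_{2j} w_{2j+1})^E = v_{2j} v_{2j+1}.
factor-identity : ∀ S T D E → 1 ≤ D → 1 ≤ E →
  pow ((b ++ pow S (D ∸ 1) ++ T ++ a⁻¹) ++ (a ++ S ++ b⁻¹)) E ≈
  (b ++ pow S (D ∸ 1) ++ T ++ a⁻¹) ++ (a ++ pow (pow S D ++ T) (E ∸ 1) ++ S ++ b⁻¹)
factor-identity S T (suc D) (suc E) _ _ = begin
  pow ((b ++ P ++ T ++ a⁻¹) ++ (a ++ S ++ b⁻¹)) (suc E)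
    ≈⟨ block-power P T S E ⟩
  (b ++ P ++ T ++ a⁻¹) ++ (a ++ pow (S ++ P ++ T) E ++ S ++ b⁻¹)
    ≡⟨ cong (λ U → (b ++ P ++ T ++ a⁻¹) ++ (a ++ pow U E ++ S ++ b⁻¹)) (++-assoc S P T) ⟨
  (b ++ P ++ T ++ a⁻¹) ++ (a ++ pow ((S ++ P) ++ T) E ++ S ++ b⁻¹)
    ∎
  where
  open ≈-Reasoning
  P = pow S D

concat-map-upTo-suc : ∀ {A : Set} (f : ℕ → List A) n →
  concat (map f (upTo (suc n))) ≡ concat (map f (upTo n)) ++ f n
concat-map-upTo-suc f n = begin
  concat (map f (upTo (suc n)))              ≡⟨ cong (λ is → concat (map f is)) (upTo-∷ʳ n) ⟨
  concat (map f (upTo n ++ [ n ]))           ≡⟨ cong concat (map-++ f (upTo n) [ n ]) ⟩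
  concat (map f (upTo n) ++ [ f n ])         ≡⟨ concat-++ (map f (upTo n)) [ f n ] ⟨
  concat (map f (upTo n)) ++ f n ++ []       ≡⟨ cong (concat (map f (upTo n)) ++_) (++-identityʳ (f n)) ⟩
  concat (map f (upTo n)) ++ f n             ∎
  where open ≡-Reasoning

+-shift : ∀ k m → + (k + m) -ℤ + k ≡ + m
+-shift k m = begin
  + (k + m) -ℤ + k  ≡⟨ [+m]-[+n]≡m⊖n (k + m) k ⟩
  _                 ≡⟨ ⊖-≥ (m≤m+n k m) ⟩
  + (k + m ∸ k)     ≡⟨ cong +_ (m+n∸m≡n k m) ⟩
  + m               ∎
  where open ≡-Reasoning

isOdd-even : ∀ n → isOdd (+ (2 * n)) ≡ false
isOdd-even n rewrite *-comm 2 n | [m+kn]%n≡m%n 0 n 2 ⦃ _ ⦄ = refl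

isOdd-odd : ∀ n → isOdd (+ suc (2 * n)) ≡ true
isOdd-odd n rewrite *-comm 2 n | [m+kn]%n≡m%n 1 n 2 ⦃ _ ⦄ = refl

module _ (d : ℕ → ℕ) where

  v-even : ∀ m → isOdd (+ m) ≡ false →
    v d (+ m) ≡ b ++ pow (s d (+ suc m)) (d (suc (suc m)) ∸ 1) ++ s d (+ m) ++ a⁻¹
  v-even m even rewrite even | +-comm m 1 | +-comm m 2 = refl

  v-odd : ∀ m → isOdd (+ m) ≡ true →
    v d (+ m) ≡ a ++ pow (s d (+ suc m)) (d (suc (suc m)) ∸ 1) ++ s d (+ m) ++ b⁻¹
  v-odd m odd rewrite odd | +-comm m 1 | +-comm m 2 = refl

  w-odd : ∀ m → isOdd (+ m) ≡ true → w d (+ m) ≡ a ++ s d (+ m) ++ b⁻¹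
  w-odd m odd rewrite odd = refl

  factor-split : (∀ i → 1 ≤ d (suc i)) → ∀ n →
    pow (v d (+ (2 * n)) ++ w d (+ suc (2 * n))) (d (3 + 2 * n)) ≈
    v d (+ (2 * n)) ++ v d (+ suc (2 * n))
  factor-split d-pos n
    rewrite v-even (2 * n) (isOdd-even n)
          | v-odd (suc (2 * n)) (isOdd-odd n)
          | w-odd (suc (2 * n)) (isOdd-odd n)
    = factor-identity (s d (+ suc (2 * n))) (s d (+ (2 * n)))
                      (d (2 + 2 * n)) (d (3 + 2 * n))
                      (d-pos (1 + 2 * n)) (d-pos (2 + 2 * n))

  lhs-factor rhs-factor : ℕ → FG
  lhs-factor i = pow (v d (+ (2 * i) -ℤ + 2) ++ w d (+ (2 * i) -ℤ + 1)) (d (2 * i + 1))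
  rhs-factor i = v d (+ i -ℤ + 1)

  lhs-factor-suc : ∀ n →
    lhs-factor (suc n) ≡ pow (v d (+ (2 * n)) ++ w d (+ suc (2 * n))) (d (3 + 2 * n))
  lhs-factor-suc n =
    cong₂ (λ x e → pow x (d e)) (cong₂ _++_ (cong (v d) even-index) (cong (w d) odd-index)) degree
    where
    even-index : + (2 * suc n) -ℤ + 2 ≡ + (2 * n)
    even-index = trans (cong (λ k → + k -ℤ + 2) (*-suc 2 n)) (+-shift 2 (2 * n))
    odd-index : + (2 * suc n) -ℤ + 1 ≡ + suc (2 * n)
    odd-index = trans (cong (λ k → + k -ℤ + 1) (*-suc 2 n)) (+-shift 1 (suc (2 * n)))
    degree : 2 * suc n + 1 ≡ 3 + 2 * n
    degree = trans (+-comm (2 * suc n) 1) (cong suc (*-suc 2 n))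

  lhs-suc : ∀ n → lhs d (suc n) ≡
    lhs d n ++ pow (v d (+ (2 * n)) ++ w d (+ suc (2 * n))) (d (3 + 2 * n))
  lhs-suc n = trans (concat-map-upTo-suc lhs-factor (suc n))
                    (cong (lhs d n ++_) (lhs-factor-suc n))

  rhs-suc : ∀ n → rhs d (suc n) ≡ rhs d n ++ v d (+ (2 * n)) ++ v d (+ suc (2 * n))
  rhs-suc n = begin
    rhs d (suc n)
      ≡⟨ cong (λ k → concat (map rhs-factor (upTo (suc k)))) (*-suc 2 n) ⟩
    concat (map rhs-factor (upTo (3 + 2 * n)))
      ≡⟨ concat-map-upTo-suc rhs-factor (2 + 2 * n) ⟩
    concat (map rhs-factor (upTo (2 + 2 * n))) ++ rhs-factor (2 + 2 * n)
      ≡⟨ cong (_++ rhs-factor (2 + 2 * n)) (concat-map-upTo-suc rhs-factor (1 + 2 * n)) ⟩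
    (rhs d n ++ rhs-factor (1 + 2 * n)) ++ rhs-factor (2 + 2 * n)
      ≡⟨ ++-assoc (rhs d n) _ _ ⟩
    rhs d n ++ rhs-factor (1 + 2 * n) ++ rhs-factor (2 + 2 * n)
      ≡⟨ cong₂ (λ x y → rhs d n ++ x ++ y) (rhs-factor-suc (2 * n)) (rhs-factor-suc (1 + 2 * n)) ⟩
    rhs d n ++ v d (+ (2 * n)) ++ v d (+ suc (2 * n))
      ∎
    where
    open ≡-Reasoning
    rhs-factor-suc : ∀ m → rhs-factor (suc m) ≡ v d (+ m)
    rhs-factor-suc m = cong (v d) (+-shift 1 m)

  -- The factor j = -1: a^{d_1} = a s_0^{d_1 - 1} s_{-1} b⁻¹ = a a^{d_1 - 1} b b⁻¹.
  first-factor : ∀ D → 1 ≤ D → pow a D ≈ a ++ pow a (D ∸ 1) ++ b ++ b⁻¹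
  first-factor (suc D) _ = begin
    a ++ pow a D               ≡⟨ cong (a ++_) (++-identityʳ (pow a D)) ⟨
    a ++ pow a D ++ []         ≈⟨ cancel-inside (a ++ pow a D) (gb , true) [] ⟨
    a ++ pow a D ++ b ++ b⁻¹   ∎
    where open ≈-Reasoning

  lhs≈rhs : (∀ i → 1 ≤ d (suc i)) → ∀ n → lhs d n ≈ rhs d n
  lhs≈rhs d-pos zero    = ++-congʳ [] (first-factor (d 1) (d-pos 0))
  lhs≈rhs d-pos (suc n) = begin
    lhs d (suc n)
      ≡⟨ lhs-suc n ⟩
    lhs d n ++ pow (v d (+ (2 * n)) ++ w d (+ suc (2 * n))) (d (3 + 2 * n))
      ≈⟨ ++-cong (lhs≈rhs d-pos n) (factor-split d-pos n) ⟩
    rhs d n ++ v d (+ (2 * n)) ++ v d (+ suc (2 * n))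
      ≡⟨ rhs-suc n ⟨
    rhs d (suc n)
      ∎
    where open ≈-Reasoning

lemma4p6 : (d : ℕ → ℕ) → (∀ i → 1 ≤ d (suc i)) → (n : ℕ) →
    norm (lhs d n) ≡ norm (rhs d n)
lemma4p6 d d-pos n = norm-≡ (lhs≈rhs d d-pos n)
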